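{- Let $k\le l$ be positive integers with $\gcd(k,l)=1$, let $n\ge1$ and $m\ge0$ be integers, and write $m=qn+r$ with integers $q\ge0$, $0\le r<n$. Then $$U^{k,l}(m,n)\le \max\bigl(nkq,\ nkq+r(k+l)-nl\bigr).$$
   Context: $\mathcal D^{k,l}(m,n)$ denotes the set of all $nk\times nl$ matrices with nonnegative integer entries all of whose row sums equal $ml$ and all of whose column sums equal $mk$. For an $s\times t$ matrix $A$ with $s\le t$, a transversal is a set of $s$ entries of $A$, one from each row, no two in the same column; $|T|$ denotes the sum of the entries of a transversal $T$. Define ${\rm tropdet}(A)=\min_T|T|$ over all transversals $T$ of $A$, and $U^{k,l}(m,n)=\max_{A\in\mathcal D^{k,l}(m,n)}{\rm tropdet}(A)$. -}

module Defs where

open import Data.Nat using (ℕ; zero; suc; _+_; _*_; _≤_)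
open import Data.Fin using (Fin)
open import Data.Product using (Σ; _×_)
open import Function.Definitions using (Injective)
open import Relation.Binary.PropositionalEquality using (_≡_)

∑ : {s : ℕ} → (Fin s → ℕ) → ℕ
∑ {zero}  f = 0
∑ {suc s} f = f Fin.zero + ∑ (λ i → f (Fin.suc i))

Matrix : ℕ → ℕ → Set
Matrix s t = Fin s → Fin t → ℕ

InD : (k l m n : ℕ) → Matrix (n * k) (n * l) → Set
InD k l m n A =
  ((i : Fin (n * k)) → ∑ (λ j → A i j) ≡ m * l) ×
  ((j : Fin (n * l)) → ∑ (λ i → A i j) ≡ m * k)

-- a transversal of an s × t matrix (s ≤ t): one entry in each row,
-- no two in the same column, i.e. an injective choice of columns
Transversal : (s t : ℕ) → Set
Transversal s t = Σ (Fin s → Fin t) (Injective _≡_ _≡_)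

weight : {s t : ℕ} → Matrix s t → Transversal s t → ℕ
weight A (σ Data.Product., _) = ∑ (λ i → A i (σ i))

-- tropdet(A) ≤ b  (tropdet = min over transversals of |T|)
TropdetAtMost : {s t : ℕ} → Matrix s t → ℕ → Set
TropdetAtMost {s} {t} A b = Σ (Transversal s t) (λ T → weight A T ≤ b)

-- U^{k,l}(m,n) ≤ b  (U = max over A ∈ 𝒟^{k,l}(m,n) of tropdet A)
UAtMost : (k l m n b : ℕ) → Set
UAtMost k l m n b =
  (A : Matrix (n * k) (n * l)) → InD k l m n A → TropdetAtMost A b

module Submission where

-- The proof goes through linear-programming duality for the assignment
-- problem, in its integral combinatorial form (Egerváry's theorem).
--
--  * Hall's theorem, in the form "a bipartite graph has a matching that
--    saturates all rows, or a set S of rows whose neighbours are covered by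
--    fewer than |S| columns", proved by induction on the number of edges.
--  * The Hungarian method: for a square matrix P there are potentials u, w
--    with u i ≤ P i j + w j for all i, j, and a permutation σ on which
--    equality holds; hence Σᵢ P i (σ i) = Σ u − Σ w.  Starting from u = w = 0,
--    Hall's theorem applied to the tight entries either yields σ or a
--    deficient set along which Σ u − Σ w can be raised.
--  * The dual bound: pad the nk × nl matrix A with zero rows to a square
--    matrix and take a column j₀ where w is minimal.  Feasibility in column
--    j₀ and along single rows bounds Σ u − Σ w by nkq when every u i − w j₀
--    is at most q, and by ml + mk − nl(q+1) otherwise.

open import Defs
open import Data.Nat using (ℕ; _+_; _*_; _∸_; _≤_; _<_; _⊔_)
open import Data.Nat.GCD using (gcd)
open import Relation.Binary.PropositionalEquality using (_≡_)

open import Data.Bool using (Bool; true; false; T; _∧_; _∨_; not)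
open import Data.Bool.Properties using (T-∧; T-∨; T?)
open import Data.Empty using (⊥-elim)
open import Data.Fin using (Fin; zero; suc; punchIn; punchOut; _≟_; _↑ˡ_; _↑ʳ_; splitAt; fromℕ<)
open import Data.Fin.Properties
  using (any?; all?; ¬∀⟶∃¬; punchIn-punchOut; punchOut-injective; punchInᵢ≢i; suc-injective;
         splitAt-↑ˡ; splitAt-↑ʳ; ↑ˡ-injective)
open import Data.Nat using (zero; suc; z≤n; s≤s; s≤s⁻¹; _<?_; _≤?_) renaming (_≟_ to _≟ℕ_)
open import Data.Nat.Properties hiding (suc-injective; _≟_)
open import Data.Nat.Tactic.RingSolver using (solve-∀)
open import Algebra.Properties.CommutativeSemigroup +-commutativeSemigroup
  using (interchange; x∙yz≈y∙xz; xy∙z≈xz∙y)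
open import Data.Product using (Σ; _×_; _,_; proj₁; proj₂)
open import Data.Sum using (_⊎_; inj₁; inj₂; [_,_]′)
open import Function using (_∘_)
open import Function.Bundles using (Equivalence)
open import Function.Definitions using (Injective)
open import Relation.Binary.PropositionalEquality using (refl; sym; trans; cong; cong₂; subst; _≢_; module ≡-Reasoning)
open import Relation.Nullary using (¬_; yes; no)
open import Relation.Nullary.Decidable using (⌊_⌋; toWitness; fromWitness; _×-dec_; ¬?)

∑-cong : ∀ {s} {f g : Fin s → ℕ} → (∀ i → f i ≡ g i) → ∑ f ≡ ∑ g
∑-cong {zero}  f≗g = refl
∑-cong {suc s} f≗g = cong₂ _+_ (f≗g zero) (∑-cong (f≗g ∘ suc))

∑-zero : ∀ {s} (f : Fin s → ℕ) → (∀ i → f i ≡ 0) → ∑ f ≡ 0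
∑-zero {zero}  f f≗0 = refl
∑-zero {suc s} f f≗0 = cong₂ _+_ (f≗0 zero) (∑-zero (f ∘ suc) (f≗0 ∘ suc))

∑-const : ∀ s c → ∑ {s} (λ _ → c) ≡ s * c
∑-const zero    c = refl
∑-const (suc s) c = cong (c +_) (∑-const s c)

∑-+ : ∀ {s} (f g : Fin s → ℕ) → ∑ (λ i → f i + g i) ≡ ∑ f + ∑ g
∑-+ {zero}  f g = refl
∑-+ {suc s} f g =
  trans (cong (f zero + g zero +_) (∑-+ (f ∘ suc) (g ∘ suc)))
        (interchange (f zero) (g zero) (∑ (f ∘ suc)) (∑ (g ∘ suc)))

∑-mono : ∀ {s} {f g : Fin s → ℕ} → (∀ i → f i ≤ g i) → ∑ f ≤ ∑ g
∑-mono {zero}  f≤g = z≤n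
∑-mono {suc s} f≤g = +-mono-≤ (f≤g zero) (∑-mono (f≤g ∘ suc))

∑-mono-< : ∀ {s} {f g : Fin s → ℕ} → (∀ i → f i ≤ g i) → (x : Fin s) → f x < g x → ∑ f < ∑ g
∑-mono-< {suc s} f≤g zero    fx<gx = +-mono-<-≤ fx<gx (∑-mono (f≤g ∘ suc))
∑-mono-< {suc s} f≤g (suc x) fx<gx = +-mono-≤-< (f≤g zero) (∑-mono-< (f≤g ∘ suc) x fx<gx)

∑-split : ∀ s e (f : Fin (s + e) → ℕ) →
          ∑ f ≡ ∑ (λ i → f (i ↑ˡ e)) + ∑ (λ i → f (s ↑ʳ i))
∑-split zero    e f = refl
∑-split (suc s) e f =
  trans (cong (f zero +_) (∑-split s e (f ∘ suc))) (sym (+-assoc (f zero) _ _))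

∑-punch : ∀ {b} (w : Fin (suc b) → ℕ) (p : Fin (suc b)) →
          ∑ w ≡ w p + ∑ (λ j → w (punchIn p j))
∑-punch w zero = refl
∑-punch {suc b} w (suc p) =
  trans (cong (w zero +_) (∑-punch (w ∘ suc) p))
        (x∙yz≈y∙xz (w zero) (w (suc p)) (∑ (λ j → w (suc (punchIn p j)))))

restrict : ∀ {a} (σ : Fin (suc a) → Fin (suc a)) → Injective _≡_ _≡_ σ →
           Σ (Fin a → Fin a) λ σ′ →
             Injective _≡_ _≡_ σ′ × (∀ i → punchIn (σ zero) (σ′ i) ≡ σ (suc i))
restrict {a} σ σ-inj = σ′ , σ′-inj , λ i → punchIn-punchOut (σ0≢σs i)
  where
  σ0≢σs : ∀ i → σ zero ≢ σ (suc i)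
  σ0≢σs i eq with σ-inj eq
  ... | ()
  σ′ : Fin a → Fin a
  σ′ i = punchOut (σ0≢σs i)
  σ′-inj : Injective _≡_ _≡_ σ′
  σ′-inj eq = suc-injective (σ-inj (punchOut-injective (σ0≢σs _) (σ0≢σs _) eq))

∑-permute : ∀ {a} (σ : Fin a → Fin a) → Injective _≡_ _≡_ σ → (w : Fin a → ℕ) →
            ∑ (λ i → w (σ i)) ≡ ∑ w
∑-permute {zero}  σ σ-inj w = refl
∑-permute {suc a} σ σ-inj w with restrict σ σ-inj
... | σ′ , σ′-inj , σ′-spec = begin
    w (σ zero) + ∑ (λ i → w (σ (suc i)))
      ≡⟨ cong (w (σ zero) +_) (∑-cong (λ i → cong w (sym (σ′-spec i)))) ⟩
    w (σ zero) + ∑ (λ i → w (punchIn (σ zero) (σ′ i)))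
      ≡⟨ cong (w (σ zero) +_) (∑-permute σ′ σ′-inj (w ∘ punchIn (σ zero))) ⟩
    w (σ zero) + ∑ (λ j → w (punchIn (σ zero) j))
      ≡⟨ sym (∑-punch w (σ zero)) ⟩
    ∑ w ∎
  where open ≡-Reasoning

-- Finite subsets, represented by their characteristic functions

Subset : ℕ → Set
Subset a = Fin a → Bool

indicator : Bool → ℕ
indicator true  = 1
indicator false = 0

∣_∣ₛ : ∀ {a} → Subset a → ℕ
∣ S ∣ₛ = ∑ (λ i → indicator (S i))

∅ : ∀ {a} → Subset a
∅ _ = false

⁅_⁆ : ∀ {a} → Fin a → Subset a
⁅ x ⁆ i = ⌊ i ≟ x ⌋

infixr 6 _∪_
infixr 7 _∩_

_∪_ : ∀ {a} → Subset a → Subset a → Subset a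
(X ∪ Y) i = X i ∨ Y i

_∩_ : ∀ {a} → Subset a → Subset a → Subset a
(X ∩ Y) i = X i ∧ Y i

_-⁅_⁆ : ∀ {a} → Subset a → Fin a → Subset a
(X -⁅ x ⁆) i = X i ∧ not (⁅ x ⁆ i)

∈⁅⁆⁻ : ∀ {a} {x i : Fin a} → T (⁅ x ⁆ i) → i ≡ x
∈⁅⁆⁻ {x = x} {i} = toWitness {a? = i ≟ x}

∈⁅⁆⁺ : ∀ {a} {x i : Fin a} → i ≡ x → T (⁅ x ⁆ i)
∈⁅⁆⁺ {x = x} {i} = fromWitness {a? = i ≟ x}

T-∨⁻ : ∀ p q → T (p ∨ q) → T p ⊎ T q
T-∨⁻ p q = Equivalence.to (T-∨ {p} {q})

T-∨ˡ : ∀ p q → T p → T (p ∨ q)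
T-∨ˡ p q = Equivalence.from (T-∨ {p} {q}) ∘ inj₁

T-∨ʳ : ∀ p q → T q → T (p ∨ q)
T-∨ʳ p q = Equivalence.from (T-∨ {p} {q}) ∘ inj₂

T-∧⁻ : ∀ p q → T (p ∧ q) → T p × T q
T-∧⁻ p q = Equivalence.to (T-∧ {p} {q})

T-∧⁺ : ∀ p q → T p × T q → T (p ∧ q)
T-∧⁺ p q = Equivalence.from (T-∧ {p} {q})

T-not⁺ : ∀ p → ¬ T p → T (not p)
T-not⁺ false _   = _
T-not⁺ true  ¬tt = ¬tt _

T-not⁻ : ∀ p → T (not p) → ¬ T p
T-not⁻ false _ ()

indicator-T : ∀ p → T p → indicator p ≡ 1
indicator-T true _ = refl

indicator-¬T : ∀ p → ¬ T p → indicator p ≡ 0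
indicator-¬T false _   = refl
indicator-¬T true  ¬tt = ⊥-elim (¬tt _)

indicator-mono : ∀ p q → (T p → T q) → indicator p ≤ indicator q
indicator-mono false q p⇒q = z≤n
indicator-mono true  q p⇒q = ≤-reflexive (sym (indicator-T q (p⇒q _)))

indicator-< : ∀ p q → ¬ T p → T q → indicator p < indicator q
indicator-< false true  _   _ = s≤s z≤n
indicator-< true  q     ¬tt _ = ⊥-elim (¬tt _)

indicator-∨∧ : ∀ p q → indicator (p ∨ q) + indicator (p ∧ q) ≡ indicator p + indicator q
indicator-∨∧ true  true  = refl
indicator-∨∧ true  false = refl
indicator-∨∧ false true  = refl
indicator-∨∧ false false = refl

indicator-remove : ∀ p q → indicator p ≤ indicator (p ∧ not q) + indicator q
indicator-remove false q     = z≤n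
indicator-remove true  false = ≤-refl
indicator-remove true  true  = ≤-refl

∣∅∣ : ∀ {a} → ∣ ∅ {a} ∣ₛ ≡ 0
∣∅∣ {a} = ∑-zero {a} (indicator ∘ ∅) (λ _ → refl)

∣⁅x⁆∣ : ∀ {a} (x : Fin a) → ∣ ⁅ x ⁆ ∣ₛ ≡ 1
∣⁅x⁆∣ {suc a} x =
  trans (∑-punch (indicator ∘ ⁅ x ⁆) x)
        (cong₂ _+_ (indicator-T (⁅ x ⁆ x) (∈⁅⁆⁺ refl))
                   (∑-zero _ (λ j → indicator-¬T (⁅ x ⁆ (punchIn x j)) (punchInᵢ≢i x j ∘ ∈⁅⁆⁻))))

∣∪∣+∣∩∣ : ∀ {a} (X Y : Subset a) → ∣ X ∪ Y ∣ₛ + ∣ X ∩ Y ∣ₛ ≡ ∣ X ∣ₛ + ∣ Y ∣ₛ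
∣∪∣+∣∩∣ X Y =
  trans (sym (∑-+ (indicator ∘ (X ∪ Y)) (indicator ∘ (X ∩ Y))))
        (trans (∑-cong (λ i → indicator-∨∧ (X i) (Y i)))
               (∑-+ (indicator ∘ X) (indicator ∘ Y)))

∣X∣≤∣X-x∣+1 : ∀ {a} (X : Subset a) (x : Fin a) → ∣ X ∣ₛ ≤ ∣ X -⁅ x ⁆ ∣ₛ + 1
∣X∣≤∣X-x∣+1 X x =
  ≤-trans (∑-mono (λ i → indicator-remove (X i) (⁅ x ⁆ i)))
          (≤-reflexive (trans (∑-+ (indicator ∘ (X -⁅ x ⁆)) (indicator ∘ ⁅ x ⁆))
                              (cong (∣ X -⁅ x ⁆ ∣ₛ +_) (∣⁅x⁆∣ x))))

∣⁅x,y⁆∣ : ∀ {a} {x y : Fin a} → x ≢ y → ∣ ⁅ x ⁆ ∪ ⁅ y ⁆ ∣ₛ ≡ 2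
∣⁅x,y⁆∣ {x = x} {y} x≢y = begin
  ∣ ⁅ x ⁆ ∪ ⁅ y ⁆ ∣ₛ                          ≡⟨ sym (+-identityʳ _) ⟩
  ∣ ⁅ x ⁆ ∪ ⁅ y ⁆ ∣ₛ + 0                      ≡⟨ cong (∣ ⁅ x ⁆ ∪ ⁅ y ⁆ ∣ₛ +_) (sym disjoint) ⟩
  ∣ ⁅ x ⁆ ∪ ⁅ y ⁆ ∣ₛ + ∣ ⁅ x ⁆ ∩ ⁅ y ⁆ ∣ₛ   ≡⟨ ∣∪∣+∣∩∣ ⁅ x ⁆ ⁅ y ⁆ ⟩
  ∣ ⁅ x ⁆ ∣ₛ + ∣ ⁅ y ⁆ ∣ₛ                     ≡⟨ cong₂ _+_ (∣⁅x⁆∣ x) (∣⁅x⁆∣ y) ⟩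
  2                                           ∎
  where
  open ≡-Reasoning
  disjoint : ∣ ⁅ x ⁆ ∩ ⁅ y ⁆ ∣ₛ ≡ 0
  disjoint = ∑-zero (indicator ∘ (⁅ x ⁆ ∩ ⁅ y ⁆)) λ i → indicator-¬T ((⁅ x ⁆ ∩ ⁅ y ⁆) i) λ i∈x∩y →
    let (i≡x , i≡y) = T-∧⁻ (⁅ x ⁆ i) (⁅ y ⁆ i) i∈x∩y
    in x≢y (trans (sym (∈⁅⁆⁻ i≡x)) (∈⁅⁆⁻ i≡y))

-- Hall's theorem

Graph : ℕ → ℕ → Set
Graph a b = Fin a → Fin b → Bool

Matching : ∀ {a b} → Graph a b → Set
Matching {a} {b} R = Σ (Fin a → Fin b) λ σ → Injective _≡_ _≡_ σ × (∀ i → T (R i (σ i)))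

record Deficient {a b} (R : Graph a b) : Set where
  field
    rows   : Subset a
    cover  : Subset b
    small  : ∣ cover ∣ₛ < ∣ rows ∣ₛ
    covers : ∀ {i j} → T (rows i) → T (R i j) → T (cover j)
open Deficient

matching-⊆ : ∀ {a b} {R′ R : Graph a b} → (∀ i j → T (R′ i j) → T (R i j)) →
             Matching R′ → Matching R
matching-⊆ R′⊆R (σ , σ-inj , σ-edge) = σ , σ-inj , λ i → R′⊆R i (σ i) (σ-edge i)

edges : ∀ {a b} → Graph a b → ℕ
edges R = ∑ λ i → ∑ λ j → indicator (R i j)

delete : ∀ {a b} → Graph a b → Fin a → Fin b → Graph a b
delete R x y i j = R i j ∧ not (⁅ x ⁆ i ∧ ⁅ y ⁆ j)

module _ {a b} (R : Graph a b) (x : Fin a) (y : Fin b) where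

  delete-⊆ : ∀ i j → T (delete R x y i j) → T (R i j)
  delete-⊆ i j = proj₁ ∘ T-∧⁻ (R i j) (not (⁅ x ⁆ i ∧ ⁅ y ⁆ j))

  delete-keeps : ∀ {i j} → ¬ (i ≡ x × j ≡ y) → T (R i j) → T (delete R x y i j)
  delete-keeps {i} {j} not-xy r =
    T-∧⁺ (R i j) _ (r , T-not⁺ (⁅ x ⁆ i ∧ ⁅ y ⁆ j) λ at-xy →
      let (i≡x , j≡y) = T-∧⁻ (⁅ x ⁆ i) (⁅ y ⁆ j) at-xy
      in not-xy (∈⁅⁆⁻ i≡x , ∈⁅⁆⁻ j≡y))

  edges-delete : T (R x y) → edges (delete R x y) < edges R
  edges-delete r =
    ∑-mono-< (λ i → ∑-mono (λ j → indicator-mono (delete R x y i j) (R i j) (delete-⊆ i j))) x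
      (∑-mono-< (λ j → indicator-mono (delete R x y x j) (R x j) (delete-⊆ x j)) y
        (indicator-< (delete R x y x y) (R x y) removed r))
    where
    removed : ¬ T (delete R x y x y)
    removed t = T-not⁻ (⁅ x ⁆ x ∧ ⁅ y ⁆ y) (proj₂ (T-∧⁻ (R x y) _ t))
                       (T-∧⁺ (⁅ x ⁆ x) (⁅ y ⁆ y) (∈⁅⁆⁺ refl , ∈⁅⁆⁺ refl))

  deficient-avoiding : (D : Deficient (delete R x y)) → ¬ T (rows D x) → Deficient R
  deficient-avoiding D x∉D = record
    { rows = rows D ; cover = cover D ; small = small D
    ; covers = λ i∈D r → covers D i∈D (delete-keeps (λ { (refl , _) → x∉D i∈D }) r) }

+-<-split : ∀ p q r s → p + q < r + s → p < r ⊎ q < s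
+-<-split p q r s lt with p <? r
... | yes p<r = inj₁ p<r
... | no  p≮r = inj₂ (+-cancelˡ-< r q s (≤-<-trans (+-monoˡ-≤ q (≮⇒≥ p≮r)) lt))

-- Submodularity: deficient sets S₁ of R − (x , j₁) and S₂ of R − (x , j₂),
-- both containing x, where j₁ ≢ j₂.  Their covers C₁, C₂ cover the
-- neighbours of S₁ ∪ S₂ and of (S₁ ∩ S₂) − x by C₁ ∪ C₂ and C₁ ∩ C₂, and by
-- inclusion–exclusion one of these two pairs is again deficient.
module Merge {a b} {R : Graph a b} {x : Fin a} {j₁ j₂ : Fin b} (j₁≢j₂ : j₁ ≢ j₂)
  (D₁ : Deficient (delete R x j₁)) (x∈S₁ : T (rows D₁ x))
  (D₂ : Deficient (delete R x j₂)) (x∈S₂ : T (rows D₂ x)) where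

  S₁ S₂ : Subset a
  S₁ = rows D₁
  S₂ = rows D₂

  C₁ C₂ : Subset b
  C₁ = cover D₁
  C₂ = cover D₂

  -- An edge at row x misses j₁ or j₂, so it survives in one of the two
  -- deleted graphs; edges at other rows survive in both.
  covers-∪ : ∀ {i j} → T ((S₁ ∪ S₂) i) → T (R i j) → T ((C₁ ∪ C₂) j)
  covers-∪ {i} {j} i∈S r with i ≟ x
  ... | no i≢x =
    [ (λ i∈S₁ → T-∨ˡ (C₁ j) (C₂ j) (covers D₁ i∈S₁ (delete-keeps R x j₁ (i≢x ∘ proj₁) r)))
    , (λ i∈S₂ → T-∨ʳ (C₁ j) (C₂ j) (covers D₂ i∈S₂ (delete-keeps R x j₂ (i≢x ∘ proj₁) r)))
    ]′ (T-∨⁻ (S₁ i) (S₂ i) i∈S)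
  ... | yes refl with j ≟ j₁
  ...   | no  j≢j₁ = T-∨ˡ (C₁ j) (C₂ j) (covers D₁ x∈S₁ (delete-keeps R x j₁ (j≢j₁ ∘ proj₂) r))
  ...   | yes refl = T-∨ʳ (C₁ j) (C₂ j) (covers D₂ x∈S₂ (delete-keeps R x j₂ (j₁≢j₂ ∘ proj₂) r))

  covers-∩ : ∀ {i j} → T (((S₁ ∩ S₂) -⁅ x ⁆) i) → T (R i j) → T ((C₁ ∩ C₂) j)
  covers-∩ {i} {j} i∈I r = T-∧⁺ (C₁ j) (C₂ j)
    ( covers D₁ (proj₁ i∈S₁∩S₂) (delete-keeps R x j₁ (i≢x ∘ proj₁) r)
    , covers D₂ (proj₂ i∈S₁∩S₂) (delete-keeps R x j₂ (i≢x ∘ proj₁) r) )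
    where
    i∈S₁∩S₂ : T (S₁ i) × T (S₂ i)
    i∈S₁∩S₂ = T-∧⁻ (S₁ i) (S₂ i) (proj₁ (T-∧⁻ ((S₁ ∩ S₂) i) (not (⁅ x ⁆ i)) i∈I))
    i≢x : i ≢ x
    i≢x i≡x = T-not⁻ (⁅ x ⁆ i) (proj₂ (T-∧⁻ ((S₁ ∩ S₂) i) (not (⁅ x ⁆ i)) i∈I)) (∈⁅⁆⁺ i≡x)

  count : ∣ C₁ ∪ C₂ ∣ₛ + ∣ C₁ ∩ C₂ ∣ₛ < ∣ S₁ ∪ S₂ ∣ₛ + ∣ (S₁ ∩ S₂) -⁅ x ⁆ ∣ₛ
  count = +-cancelʳ-< 1 _ _ (begin-strict
    ∣ C₁ ∪ C₂ ∣ₛ + ∣ C₁ ∩ C₂ ∣ₛ + 1      ≡⟨ cong (_+ 1) (∣∪∣+∣∩∣ C₁ C₂) ⟩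
    ∣ C₁ ∣ₛ + ∣ C₂ ∣ₛ + 1                 ≡⟨ +-assoc ∣ C₁ ∣ₛ ∣ C₂ ∣ₛ 1 ⟩
    ∣ C₁ ∣ₛ + (∣ C₂ ∣ₛ + 1)               ≡⟨ cong (∣ C₁ ∣ₛ +_) (+-comm ∣ C₂ ∣ₛ 1) ⟩
    ∣ C₁ ∣ₛ + suc ∣ C₂ ∣ₛ                 <⟨ +-mono-≤ (small D₁) (small D₂) ⟩
    ∣ S₁ ∣ₛ + ∣ S₂ ∣ₛ                     ≡⟨ sym (∣∪∣+∣∩∣ S₁ S₂) ⟩
    ∣ S₁ ∪ S₂ ∣ₛ + ∣ S₁ ∩ S₂ ∣ₛ           ≤⟨ +-monoʳ-≤ ∣ S₁ ∪ S₂ ∣ₛ (∣X∣≤∣X-x∣+1 (S₁ ∩ S₂) x) ⟩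
    ∣ S₁ ∪ S₂ ∣ₛ + (∣ (S₁ ∩ S₂) -⁅ x ⁆ ∣ₛ + 1)  ≡⟨ sym (+-assoc ∣ S₁ ∪ S₂ ∣ₛ _ 1) ⟩
    ∣ S₁ ∪ S₂ ∣ₛ + ∣ (S₁ ∩ S₂) -⁅ x ⁆ ∣ₛ + 1    ∎)
    where open ≤-Reasoning

  merged : Deficient R
  merged with +-<-split _ _ _ _ count
  ... | inj₁ small-∪ = record
    { rows = S₁ ∪ S₂ ; cover = C₁ ∪ C₂ ; small = small-∪ ; covers = covers-∪ }
  ... | inj₂ small-∩ = record
    { rows = (S₁ ∩ S₂) -⁅ x ⁆ ; cover = C₁ ∩ C₂ ; small = small-∩ ; covers = covers-∩ }

-- When every row has at most one neighbour: an isolated row, or two rows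
-- sharing their neighbour, form a deficient set; otherwise the neighbour
-- function is a matching.
module Functional {a b} (R : Graph a b)
  (unique : ∀ {x j₁ j₂} → T (R x j₁) → T (R x j₂) → j₁ ≡ j₂) where

  isolated-row : (x : Fin a) → ¬ Σ (Fin b) (λ j → T (R x j)) → Deficient R
  isolated-row x isolated = record
    { rows = ⁅ x ⁆ ; cover = ∅
    ; small = ≤-trans (≤-reflexive (cong suc (∣∅∣ {b}))) (≤-reflexive (sym (∣⁅x⁆∣ x)))
    ; covers = λ { {i} {j} i∈⁅x⁆ r → ⊥-elim (isolated (j , subst-row (∈⁅⁆⁻ i∈⁅x⁆) r)) } }
    where
    subst-row : ∀ {i j} → i ≡ x → T (R i j) → T (R x j)
    subst-row refl r = r

  module _ (nbr : (x : Fin a) → Σ (Fin b) (λ j → T (R x j))) where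

    shared-neighbour : ∀ {x y} → x ≢ y → proj₁ (nbr x) ≡ proj₁ (nbr y) → Deficient R
    shared-neighbour {x} {y} x≢y same = record
      { rows = ⁅ x ⁆ ∪ ⁅ y ⁆ ; cover = ⁅ proj₁ (nbr x) ⁆
      ; small = ≤-trans (≤-reflexive (cong suc (∣⁅x⁆∣ (proj₁ (nbr x)))))
                        (≤-reflexive (sym (∣⁅x,y⁆∣ x≢y)))
      ; covers = λ {i} i∈xy r → ∈⁅⁆⁺ (trans (unique r (proj₂ (nbr i))) (nbr-i≡nbr-x i∈xy)) }
      where
      nbr-i≡nbr-x : ∀ {i} → T ((⁅ x ⁆ ∪ ⁅ y ⁆) i) → proj₁ (nbr i) ≡ proj₁ (nbr x)
      nbr-i≡nbr-x i∈xy =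
        [ (λ i∈x → cong (proj₁ ∘ nbr) (∈⁅⁆⁻ i∈x))
        , (λ i∈y → trans (cong (proj₁ ∘ nbr) (∈⁅⁆⁻ i∈y)) (sym same)) ]′ (T-∨⁻ (⁅ x ⁆ _) (⁅ y ⁆ _) i∈xy)

    neighbour-matching : (∀ {x y} → x ≢ y → proj₁ (nbr x) ≢ proj₁ (nbr y)) → Matching R
    neighbour-matching distinct = proj₁ ∘ nbr , injective , proj₂ ∘ nbr
      where
      injective : Injective _≡_ _≡_ (proj₁ ∘ nbr)
      injective {x} {y} same with x ≟ y
      ... | yes x≡y = x≡y
      ... | no  x≢y = ⊥-elim (distinct x≢y same)

  hall-functional : Matching R ⊎ Deficient R
  hall-functional with all? (λ x → any? (λ j → T? (R x j)))
  ... | no ¬all = let (x , isolated) = ¬∀⟶∃¬ a _ (λ x → any? (λ j → T? (R x j))) ¬all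
                  in inj₂ (isolated-row x isolated)
  ... | yes nbr with any? (λ x → any? (λ y → ¬? (x ≟ y) ×-dec (proj₁ (nbr x) ≟ proj₁ (nbr y))))
  ...   | yes (x , y , x≢y , same) = inj₂ (shared-neighbour nbr x≢y same)
  ...   | no  no-clash = inj₁ (neighbour-matching nbr λ x≢y same → no-clash (_ , _ , x≢y , same))

-- Hall's alternative, by induction on the number of edges: a row x with two
-- neighbours j₁ ≢ j₂ is split by deleting either edge.
hall-by-edges : ∀ {a b} (fuel : ℕ) (R : Graph a b) → edges R < fuel → Matching R ⊎ Deficient R
hall-by-edges zero R ()
hall-by-edges (suc fuel) R (s≤s edges≤fuel)
  with any? (λ x → any? (λ j₁ → any? (λ j₂ → T? (R x j₁) ×-dec T? (R x j₂) ×-dec ¬? (j₁ ≟ j₂))))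
... | yes (x , j₁ , j₂ , r₁ , r₂ , j₁≢j₂) =
  branch j₁≢j₂ (hall-by-edges fuel (delete R x j₁) (≤-trans (edges-delete R x j₁ r₁) edges≤fuel))
               (hall-by-edges fuel (delete R x j₂) (≤-trans (edges-delete R x j₂ r₂) edges≤fuel))
  where
  branch : ∀ {j₁ j₂} → j₁ ≢ j₂ →
           Matching (delete R x j₁) ⊎ Deficient (delete R x j₁) →
           Matching (delete R x j₂) ⊎ Deficient (delete R x j₂) → Matching R ⊎ Deficient R
  branch {j₁}      _ (inj₁ M) _        = inj₁ (matching-⊆ (delete-⊆ R x j₁) M)
  branch {_} {j₂}  _ (inj₂ _) (inj₁ M) = inj₁ (matching-⊆ (delete-⊆ R x j₂) M)
  branch j₁≢j₂ (inj₂ D₁) (inj₂ D₂) with T? (rows D₁ x) | T? (rows D₂ x)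
  ... | no  x∉S₁ | _          = inj₂ (deficient-avoiding R x _ D₁ x∉S₁)
  ... | yes _    | no  x∉S₂   = inj₂ (deficient-avoiding R x _ D₂ x∉S₂)
  ... | yes x∈S₁ | yes x∈S₂   = inj₂ (Merge.merged j₁≢j₂ D₁ x∈S₁ D₂ x∈S₂)
... | no no-branching = Functional.hall-functional R unique
  where
  unique : ∀ {x j₁ j₂} → T (R x j₁) → T (R x j₂) → j₁ ≡ j₂
  unique {x} {j₁} {j₂} r₁ r₂ with j₁ ≟ j₂
  ... | yes j₁≡j₂ = j₁≡j₂
  ... | no  j₁≢j₂ = ⊥-elim (no-branching (x , j₁ , j₂ , r₁ , r₂ , j₁≢j₂))

hall : ∀ {a b} (R : Graph a b) → Matching R ⊎ Deficient R
hall R = hall-by-edges (suc (edges R)) R ≤-refl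

-- Egerváry's theorem: optimal assignments and dual potentials

-- Row potentials u and column potentials w are feasible for P when they
-- satisfy every dual constraint of the assignment problem.
Feasible : ∀ {a b} → Matrix a b → (Fin a → ℕ) → (Fin b → ℕ) → Set
Feasible P u w = ∀ i j → u i ≤ P i j + w j

tight : ∀ {a b} → Matrix a b → (Fin a → ℕ) → (Fin b → ℕ) → Graph a b
tight P u w i j = ⌊ u i ≟ℕ P i j + w j ⌋

-- A permutation σ together with feasible potentials that are tight along σ;
-- by complementary slackness σ is then a transversal of minimal weight.
record Certificate {a} (P : Matrix a a) : Set where
  field
    σ             : Fin a → Fin a
    σ-injective   : Injective _≡_ _≡_ σ
    u w           : Fin a → ℕ
    feasible      : Feasible P u w
    tight-along-σ : ∀ i → u i ≡ P i (σ i) + w (σ i)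

certificate-weight : ∀ {a} {P : Matrix a a} (C : Certificate P) →
                     let open Certificate C in ∑ (λ i → P i (σ i)) + ∑ w ≡ ∑ u
certificate-weight {P = P} C = begin
  ∑ (λ i → P i (σ i)) + ∑ w                ≡⟨ cong (∑ (λ i → P i (σ i)) +_) (sym (∑-permute σ σ-injective w)) ⟩
  ∑ (λ i → P i (σ i)) + ∑ (λ i → w (σ i))  ≡⟨ sym (∑-+ (λ i → P i (σ i)) (λ i → w (σ i))) ⟩
  ∑ (λ i → P i (σ i) + w (σ i))            ≡⟨ sym (∑-cong tight-along-σ) ⟩
  ∑ u                                      ∎
  where
  open Certificate C
  open ≡-Reasoning

weak-duality : ∀ {a} {P : Matrix a a} {u w : Fin a → ℕ} → Feasible P u w →
               ∑ u ≤ ∑ (λ i → P i i) + ∑ w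
weak-duality {P = P} {u} {w} feasible =
  ≤-trans (∑-mono (λ i → feasible i i)) (≤-reflexive (∑-+ (λ i → P i i) w))

raise : ∀ {a} → (Fin a → ℕ) → Subset a → Fin a → ℕ
raise u S i = u i + indicator (S i)

raise-≤ : ∀ {x y} p q → x ≤ y → (T p → x ≡ y → T q) → x + indicator p ≤ y + indicator q
raise-≤ {x} {y} false q     x≤y _ =
  ≤-trans (≤-reflexive (+-identityʳ x)) (≤-trans x≤y (m≤m+n y (indicator q)))
raise-≤         true  true  x≤y _ = +-monoˡ-≤ 1 x≤y
raise-≤ {x} {y} true  false x≤y raised⇒ =
  ≤-trans (≤-reflexive (+-comm x 1))
          (≤-trans (≤∧≢⇒< x≤y (raised⇒ _)) (≤-reflexive (sym (+-identityʳ y))))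

raise-feasible : ∀ {a b} {P : Matrix a b} {u w} → Feasible P u w →
                 (D : Deficient (tight P u w)) →
                 Feasible P (raise u (rows D)) (raise w (cover D))
raise-feasible {P = P} {u} {w} feasible D i j =
  ≤-trans (raise-≤ (rows D i) (cover D j) (feasible i j)
                   (λ i∈S u≡ → covers D i∈S (fromWitness {a? = u i ≟ℕ P i j + w j} u≡)))
          (≤-reflexive (+-assoc (P i j) (w j) (indicator (cover D j))))

raise-gap : ∀ {a b} (d : ℕ) (u : Fin a → ℕ) (w : Fin b → ℕ) (S : Subset a) (C : Subset b)
            (fuel : ℕ) → ∣ C ∣ₛ < ∣ S ∣ₛ → d + ∑ w < ∑ u + suc fuel →
            d + ∑ (raise w C) < ∑ (raise u S) + fuel
raise-gap d u w S C fuel C<S gap = begin-strict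
  d + ∑ (raise w C)       ≡⟨ cong (d +_) (∑-+ w (indicator ∘ C)) ⟩
  d + (∑ w + ∣ C ∣ₛ)      ≡⟨ sym (+-assoc d (∑ w) ∣ C ∣ₛ) ⟩
  d + ∑ w + ∣ C ∣ₛ        <⟨ +-mono-≤-< (s≤s⁻¹ (subst (d + ∑ w <_) (+-suc (∑ u) fuel) gap)) C<S ⟩
  ∑ u + fuel + ∣ S ∣ₛ     ≡⟨ xy∙z≈xz∙y (∑ u) fuel ∣ S ∣ₛ ⟩
  ∑ u + ∣ S ∣ₛ + fuel     ≡⟨ cong (_+ fuel) (sym (∑-+ u (indicator ∘ S))) ⟩
  ∑ (raise u S) + fuel    ∎
  where open ≤-Reasoning

-- The Hungarian method.  By weak duality ∑ u − ∑ w never exceeds the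
-- diagonal weight, so the fuel bounds the number of raising steps.
hungarian : ∀ {a} (P : Matrix a a) (fuel : ℕ) (u w : Fin a → ℕ) → Feasible P u w →
            ∑ (λ i → P i i) + ∑ w < ∑ u + fuel → Certificate P
hungarian P zero u w feasible gap =
  ⊥-elim (<⇒≱ (subst (∑ (λ i → P i i) + ∑ w <_) (+-identityʳ (∑ u)) gap)
               (weak-duality {P = P} feasible))
hungarian P (suc fuel) u w feasible gap with hall (tight P u w)
... | inj₁ (σ , σ-injective , σ-tight) = record
  { σ = σ ; σ-injective = σ-injective ; u = u ; w = w ; feasible = feasible
  ; tight-along-σ = λ i → toWitness {a? = u i ≟ℕ P i (σ i) + w (σ i)} (σ-tight i) }
... | inj₂ D = hungarian P fuel (raise u (rows D)) (raise w (cover D))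
                 (raise-feasible {P = P} feasible D)
                 (raise-gap _ u w (rows D) (cover D) fuel (small D) gap)

egervary : ∀ {a} (P : Matrix a a) → Certificate P
egervary {a} P = hungarian P (suc diagonal) (λ _ → 0) (λ _ → 0) (λ _ _ → z≤n) start
  where
  diagonal : ℕ
  diagonal = ∑ (λ i → P i i)
  ∑0 : ∑ {a} (λ _ → 0) ≡ 0
  ∑0 = ∑-zero {a} (λ _ → 0) (λ _ → refl)
  start : diagonal + ∑ {a} (λ _ → 0) < ∑ {a} (λ _ → 0) + suc diagonal
  start = begin-strict
    diagonal + ∑ {a} (λ _ → 0)   ≡⟨ trans (cong (diagonal +_) ∑0) (+-identityʳ diagonal) ⟩
    diagonal                     <⟨ n<1+n diagonal ⟩
    suc diagonal                 ≡⟨ cong (_+ suc diagonal) (sym ∑0) ⟩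
    ∑ {a} (λ _ → 0) + suc diagonal ∎
    where open ≤-Reasoning

padRows : ∀ {s t} e → Matrix s t → Matrix (s + e) t
padRows {s} e A i j = [ (λ i′ → A i′ j) , (λ _ → 0) ]′ (splitAt s i)

padRows-↑ˡ : ∀ {s t} e (A : Matrix s t) i j → padRows e A (i ↑ˡ e) j ≡ A i j
padRows-↑ˡ {s} e A i j rewrite splitAt-↑ˡ s i e = refl

padRows-↑ʳ : ∀ {s t} e (A : Matrix s t) i j → padRows e A (s ↑ʳ i) j ≡ 0
padRows-↑ʳ {s} e A i j rewrite splitAt-↑ʳ s e i = refl

padRows-row-sum : ∀ {s t} e (A : Matrix s t) {ρ} → (∀ i → ∑ (λ j → A i j) ≤ ρ) →
                  ∀ i → ∑ (λ j → padRows e A i j) ≤ ρ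
padRows-row-sum {s} {t} e A row-sum i with splitAt s i
... | inj₁ i′ = row-sum i′
... | inj₂ _  = ≤-trans (≤-reflexive (∑-zero {t} (λ _ → 0) (λ _ → refl))) z≤n

padRows-column-sum : ∀ {s t} e (A : Matrix s t) j →
                     ∑ (λ i → padRows e A i j) ≡ ∑ (λ i → A i j)
padRows-column-sum {s} e A j = begin
  ∑ (λ i → padRows e A i j)
    ≡⟨ ∑-split s e (λ i → padRows e A i j) ⟩
  ∑ (λ i → padRows e A (i ↑ˡ e) j) + ∑ (λ i → padRows e A (s ↑ʳ i) j)
    ≡⟨ cong₂ _+_ (∑-cong (λ i → padRows-↑ˡ e A i j))
                 (∑-zero (λ i → padRows e A (s ↑ʳ i) j) (λ i → padRows-↑ʳ e A i j)) ⟩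
  ∑ (λ i → A i j) + 0
    ≡⟨ +-identityʳ _ ⟩
  ∑ (λ i → A i j) ∎
  where open ≡-Reasoning

argmin : ∀ {b} → Fin b → (w : Fin b → ℕ) → Σ (Fin b) λ j₀ → ∀ j → w j₀ ≤ w j
argmin {suc zero}    _ w = zero , λ { zero → ≤-refl }
argmin {suc (suc b)} _ w with argmin zero (w ∘ suc)
... | j , j-min with w zero ≤? w (suc j)
...   | yes w₀≤ = zero  , λ { zero → ≤-refl ; (suc i) → ≤-trans w₀≤ (j-min i) }
...   | no  w₀≰ = suc j , λ { zero → <⇒≤ (≰⇒> w₀≰) ; (suc i) → j-min i }

∸-shift : ∀ {a c x y} → a + c ≤ x + y → a ≤ (x ∸ c) + y
∸-shift {a} {zero}          a+c≤ = ≤-trans (≤-reflexive (sym (+-identityʳ a))) a+c≤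
∸-shift {a} {suc c} {zero}  a+c≤ = ≤-trans (m≤m+n a (suc c)) a+c≤
∸-shift {a} {suc c} {suc x} a+c≤ =
  ∸-shift {a} {c} {x} (s≤s⁻¹ (≤-trans (≤-reflexive (sym (+-suc a c))) a+c≤))

-- Feasibility in column j₀ bounds the excess
-- u i − w j₀ of each row by its entry in that column.
module DualBound {s e : ℕ} (A : Matrix s (s + e)) (ρ γ : ℕ)
  (row-sum : ∀ i → ∑ (λ j → A i j) ≤ ρ) (column-sum : ∀ j → ∑ (λ i → A i j) ≤ γ)
  (u w : Fin (s + e) → ℕ) (feasible : Feasible (padRows e A) u w)
  (j₀ : Fin (s + e)) (j₀-min : ∀ j → w j₀ ≤ w j) where

  t : ℕ
  t = s + e

  P : Matrix t t
  P = padRows e A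

  M : ℕ
  M = w j₀

  excess : Fin t → ℕ
  excess i = u i ∸ M

  excess≤entry : ∀ i → excess i ≤ P i j₀
  excess≤entry i = m≤n+o⇒m∸n≤o (u i) M (≤-trans (feasible i j₀) (≤-reflexive (+-comm (P i j₀) M)))

  ∑u≤ : ∑ u ≤ t * M + ∑ excess
  ∑u≤ = ≤-trans (∑-mono (λ i → m≤n+m∸n (u i) M))
                (≤-reflexive (trans (∑-+ (λ _ → M) excess) (cong (_+ ∑ excess) (∑-const t M))))

  tM≤∑w : t * M ≤ ∑ w
  tM≤∑w = ≤-trans (≤-reflexive (sym (∑-const t M))) (∑-mono j₀-min)

  ∑excess≤γ : ∑ excess ≤ γ
  ∑excess≤γ = ≤-trans (∑-mono excess≤entry)
                      (≤-trans (≤-reflexive (padRows-column-sum e A j₀)) (column-sum j₀))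

  row-bound : ∀ i → t * u i ≤ ρ + ∑ w
  row-bound i = begin
    t * u i                   ≡⟨ sym (∑-const t (u i)) ⟩
    ∑ {t} (λ _ → u i)         ≤⟨ ∑-mono (feasible i) ⟩
    ∑ (λ j → P i j + w j)     ≡⟨ ∑-+ (P i) w ⟩
    ∑ (P i) + ∑ w             ≤⟨ +-monoˡ-≤ (∑ w) (padRows-row-sum e A row-sum i) ⟩
    ρ + ∑ w                   ∎
    where open ≤-Reasoning

  -- If every excess is at most q, the s genuine rows contribute at most q
  -- each and the zero rows nothing.
  all-small : ∀ q → (∀ i → excess i ≤ q) → ∑ u ≤ s * q + ∑ w
  all-small q small = begin
    ∑ u                       ≤⟨ ∑u≤ ⟩
    t * M + ∑ excess          ≡⟨ cong (t * M +_) (∑-split s e excess) ⟩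
    t * M + (∑ (λ i → excess (i ↑ˡ e)) + ∑ (λ i → excess (s ↑ʳ i)))
      ≤⟨ +-mono-≤ tM≤∑w (+-mono-≤ (∑-mono (λ i → small (i ↑ˡ e))) (∑-mono padding-rows)) ⟩
    ∑ w + (∑ {s} (λ _ → q) + ∑ {e} (λ _ → 0))
      ≡⟨ cong (∑ w +_) (cong₂ _+_ (∑-const s q) (∑-zero {e} (λ _ → 0) (λ _ → refl))) ⟩
    ∑ w + (s * q + 0)         ≡⟨ trans (cong (∑ w +_) (+-identityʳ (s * q))) (+-comm (∑ w) (s * q)) ⟩
    s * q + ∑ w               ∎
    where
    open ≤-Reasoning
    padding-rows : ∀ i → excess (s ↑ʳ i) ≤ 0
    padding-rows i = ≤-trans (excess≤entry (s ↑ʳ i)) (≤-reflexive (padRows-↑ʳ e A i j₀))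

  -- If row i has excess above q, its dual constraints force ∑ w to be large.
  one-large : ∀ q i → q < excess i → ∑ u ≤ (ρ + γ) ∸ t * suc q + ∑ w
  one-large q i q<excess = ∸-shift (begin
    ∑ u + t * suc q               ≤⟨ +-monoˡ-≤ (t * suc q) (≤-trans ∑u≤ (+-monoʳ-≤ (t * M) ∑excess≤γ)) ⟩
    t * M + γ + t * suc q         ≡⟨ xy∙z≈xz∙y (t * M) γ (t * suc q) ⟩
    t * M + t * suc q + γ         ≡⟨ cong (_+ γ) (sym (*-distribˡ-+ t M (suc q))) ⟩
    t * (M + suc q) + γ           ≤⟨ +-monoˡ-≤ γ (≤-trans (*-monoʳ-≤ t M+q<u) (row-bound i)) ⟩
    ρ + ∑ w + γ                   ≡⟨ xy∙z≈xz∙y ρ (∑ w) γ ⟩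
    ρ + γ + ∑ w                   ∎)
    where
    open ≤-Reasoning
    M≤u : M ≤ u i
    M≤u = <⇒≤ (m∸n≢0⇒n<m λ excess≡0 → n≮0 (subst (q <_) excess≡0 q<excess))
    M+q<u : M + suc q ≤ u i
    M+q<u = ≤-trans (+-monoʳ-≤ M q<excess) (≤-reflexive (m+[n∸m]≡n M≤u))

  dual-bound : ∀ q → ∑ u ≤ (s * q) ⊔ ((ρ + γ) ∸ t * suc q) + ∑ w
  dual-bound q with any? (λ i → q <? excess i)
  ... | yes (i , q<excess) =
    ≤-trans (one-large q i q<excess) (+-monoˡ-≤ (∑ w) (m≤n⊔m (s * q) _))
  ... | no  none-large =
    ≤-trans (all-small q (λ i → ≮⇒≥ (none-large ∘ (i ,_)))) (+-monoˡ-≤ (∑ w) (m≤m⊔n (s * q) _))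

-- The optimal
-- permutation of the padded square matrix restricts to a transversal of A.
tropdet-bound : ∀ {s t} (A : Matrix s t) → s ≤ t → 0 < t → (ρ γ q : ℕ) →
                (∀ i → ∑ (λ j → A i j) ≤ ρ) → (∀ j → ∑ (λ i → A i j) ≤ γ) →
                TropdetAtMost A ((s * q) ⊔ ((ρ + γ) ∸ t * suc q))
tropdet-bound {s} A s≤t 0<t ρ γ q row-sum column-sum with m≤n⇒∃[o]m+o≡n s≤t
... | e , refl = (τ , τ-injective) , weight-bound
  where
  open Certificate (egervary (padRows e A))
  P : Matrix (s + e) (s + e)
  P = padRows e A
  τ : Fin s → Fin (s + e)
  τ i = σ (i ↑ˡ e)
  τ-injective : Injective _≡_ _≡_ τ
  τ-injective eq = ↑ˡ-injective e _ _ (σ-injective eq)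
  weight≤cost : ∑ (λ i → A i (τ i)) ≤ ∑ (λ i → P i (σ i))
  weight≤cost = begin
    ∑ (λ i → A i (τ i))                     ≡⟨ sym (∑-cong (λ i → padRows-↑ˡ e A i (τ i))) ⟩
    ∑ (λ i → P (i ↑ˡ e) (σ (i ↑ˡ e)))       ≤⟨ m≤m+n _ _ ⟩
    ∑ (λ i → P (i ↑ˡ e) (σ (i ↑ˡ e))) + ∑ (λ i → P (s ↑ʳ i) (σ (s ↑ʳ i)))
                                            ≡⟨ sym (∑-split s e (λ i → P i (σ i))) ⟩
    ∑ (λ i → P i (σ i))                     ∎
    where open ≤-Reasoning
  j₀-min = argmin (fromℕ< 0<t) w
  weight-bound : ∑ (λ i → A i (τ i)) ≤ (s * q) ⊔ ((ρ + γ) ∸ (s + e) * suc q)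
  weight-bound = +-cancelʳ-≤ (∑ w) _ _ (begin
    ∑ (λ i → A i (τ i)) + ∑ w   ≤⟨ +-monoˡ-≤ (∑ w) weight≤cost ⟩
    ∑ (λ i → P i (σ i)) + ∑ w   ≡⟨ certificate-weight (egervary P) ⟩
    ∑ u                         ≤⟨ DualBound.dual-bound A ρ γ row-sum column-sum u w feasible
                                     (proj₁ j₀-min) (proj₂ j₀-min) q ⟩
    (s * q) ⊔ ((ρ + γ) ∸ (s + e) * suc q) + ∑ w ∎)
    where open ≤-Reasoning

-- With s = nk, t = nl, ρ = ml, γ = mk and m = qn + r, the bound of
-- tropdet-bound is the claimed one, since
-- ml + mk = nlq + (nkq + r(k + l)) and nl(q + 1) = nlq + nl.
mainTheorem12 : (k l n m q r : ℕ) → 1 ≤ k → k ≤ l → gcd k l ≡ 1 → 1 ≤ n →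
    m ≡ q * n + r → r < n →
    UAtMost k l m n ((n * k * q) ⊔ ((n * k * q + r * (k + l)) ∸ n * l))
mainTheorem12 k l n .(q * n + r) q r 1≤k k≤l _ 1≤n refl _ A (row-sums , column-sums) =
  subst (TropdetAtMost A) (cong (n * k * q ⊔_) excess-identity)
    (tropdet-bound A (*-monoʳ-≤ n k≤l) (*-mono-≤ 1≤n (≤-trans 1≤k k≤l))
                   (m * l) (m * k) q (≤-reflexive ∘ row-sums) (≤-reflexive ∘ column-sums))
  where
  m : ℕ
  m = q * n + r
  total-mass : ∀ q n r k l → (q * n + r) * l + (q * n + r) * k ≡
                                n * l * q + (n * k * q + r * (k + l))
  total-mass = solve-∀
  column-mass : ∀ n l q → n * l * suc q ≡ n * l * q + n * l
  column-mass = solve-∀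
  excess-identity : (m * l + m * k) ∸ n * l * suc q ≡ (n * k * q + r * (k + l)) ∸ n * l
  excess-identity = begin
    (m * l + m * k) ∸ n * l * suc q
      ≡⟨ cong₂ _∸_ (total-mass q n r k l) (column-mass n l q) ⟩
    (n * l * q + (n * k * q + r * (k + l))) ∸ (n * l * q + n * l)
      ≡⟨ [m+n]∸[m+o]≡n∸o (n * l * q) _ (n * l) ⟩
    (n * k * q + r * (k + l)) ∸ n * l ∎
    where open ≡-Reasoning
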